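{- Let $S$ be a random subset of a finite set $L$ and $T$ a random subset of a finite set $R$, and let $(l,r)\in L\times R$. Suppose that all events $\{l'\in S\}$ for $l'\ne l$ and all events $\{r'\in T\}$ for $r'\ne r$ are jointly independent of the event $\{(l,r)\in S\times T\}$. Let $s$ be an element of $S$ chosen uniformly at random and $t$ an element of $T$ chosen uniformly at random ($(s,t)$ is undefined if $S=\varnothing$ or $T=\varnothing$). Then $$\Pr[(l,r)=(s,t)]\ge\frac{\Pr[(l,r)\in S\times T]}{(\mathbb{E}[|S|]+1)(\mathbb{E}[|T|]+1)}.$$
   Formalization: The joint distribution of the random subsets $S$ and $T$ assigns rational probabilities to all pairs of subsets. -}

module Defs where

open import Data.Bool using (Bool; true; false; _∧_; _∨_; if_then_else_)
open import Data.Bool.Properties using () renaming (_≟_ to _≟ᵇ_)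
open import Data.Nat using (ℕ; zero; suc) renaming (_*_ to _*ℕ_)
open import Data.Integer using (+_)
open import Data.Fin using (Fin; _≟_)
open import Data.Fin.Subset using (Subset; ∣_∣)
open import Data.Vec using (Vec; []; _∷_; lookup)
open import Data.List using (List; []; _∷_; map; concatMap; foldr; _++_; allFin)
open import Data.Bool.ListAction using (and)
open import Data.Rational using (ℚ; 0ℚ; 1ℚ; _+_; _*_; _/_)
open import Data.Product using (_×_)
open import Relation.Nullary.Decidable using (⌊_⌋)
open import Relation.Binary.PropositionalEquality using (_≡_)
import Data.Rational as Q

allSubsets : (n : ℕ) → List (Subset n)
allSubsets zero = [] ∷ []
allSubsets (suc n) = map (true ∷_) (allSubsets n) ++ map (false ∷_) (allSubsets n)

sumℚ : List ℚ → ℚ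
sumℚ = foldr _+_ 0ℚ

-- A random pair (S , T) of subsets of L = Fin m and R = Fin n is given by its
-- joint probability mass function  p : Subset m → Subset n → ℚ.
-- Sum of a function over all outcomes (S , T).
ΣST : ∀ {m n} → (Subset m → Subset n → ℚ) → ℚ
ΣST {m} {n} f = sumℚ (concatMap (λ S → map (f S) (allSubsets n)) (allSubsets m))

IsDistribution : ∀ {m n} → (Subset m → Subset n → ℚ) → Set
IsDistribution p = (∀ S T → 0ℚ Q.≤ p S T) × (ΣST p ≡ 1ℚ)

Pr : ∀ {m n} → (Subset m → Subset n → ℚ) → (Subset m → Subset n → Bool) → ℚ
Pr p ev = ΣST (λ S T → if ev S T then p S T else 0ℚ)

natℚ : ℕ → ℚ
natℚ k = + k / 1

ExpCardS : ∀ {m n} → (Subset m → Subset n → ℚ) → ℚ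
ExpCardS p = ΣST (λ S T → p S T * natℚ ∣ S ∣)

ExpCardT : ∀ {m n} → (Subset m → Subset n → ℚ) → ℚ
ExpCardT p = ΣST (λ S T → p S T * natℚ ∣ T ∣)

InSxT : ∀ {m n} → Fin m → Fin n → Subset m → Subset n → Bool
InSxT l r S T = lookup S l ∧ lookup T r

agreeOff : ∀ {k} → Fin k → Subset k → Subset k → Bool
agreeOff {k} x A X = and (map (λ i → ⌊ i ≟ x ⌋ ∨ ⌊ lookup A i ≟ᵇ lookup X i ⌋) (allFin k))

-- The atom of σ({l' ∈ S} : l' ≠ l, {r' ∈ T} : r' ≠ r) given by the pattern (A , B).
Atom : ∀ {m n} → Fin m → Fin n → Subset m → Subset n → Subset m → Subset n → Bool
Atom l r A B S T = agreeOff l A S ∧ agreeOff r B T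

-- The events {l' ∈ S} (l' ≠ l) and {r' ∈ T} (r' ≠ r) are jointly independent
-- of the event {(l , r) ∈ S × T}: the σ-algebra they generate is independent of
-- it, i.e. every atom of that σ-algebra is independent of it.
JointlyIndependent : ∀ {m n} → (Subset m → Subset n → ℚ) → Fin m → Fin n → Set
JointlyIndependent p l r =
  ∀ A B → Pr p (λ S T → Atom l r A B S T ∧ InSxT l r S T)
          ≡ Pr p (Atom l r A B) * Pr p (InSxT l r)

-- 1 / k  (with the harmless convention 1/0 = 0; only used for k ≥ 1).
invℕ : ℕ → ℚ
invℕ zero = 0ℚ
invℕ (suc k) = + 1 / suc k

-- Pr[(l , r) = (s , t)] where s, t are uniform in S, T (conditionally on (S , T)).
-- Given (S , T) with l ∈ S and r ∈ T this probability is 1/(|S| |T|); otherwise 0.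
PrPick : ∀ {m n} → (Subset m → Subset n → ℚ) → Fin m → Fin n → ℚ
PrPick p l r = ΣST (λ S T → if InSxT l r S T then p S T * invℕ (∣ S ∣ *ℕ ∣ T ∣) else 0ℚ)

-- The function (x , y) ↦ 1 / (x y) is convex on the positive quadrant. Its tangent plane at
-- (α , β), multiplied by (α β)², is the AM-GM inequality
--   3 α β ≤ (α β)² / (x y) + β x + α y.
-- Apply it to x = |S|, y = |T| on the event E = {(l , r) ∈ S × T}, with α = 𝔼|S| + 1 and
-- β = 𝔼|T| + 1, and take expectations. On E we have |S| ≤ |S ∪ {l}| and |T| ≤ |T ∪ {r}|, and
-- these two quantities are determined by the events {l′ ∈ S} (l′ ≠ l) and {r′ ∈ T} (r′ ≠ r).
-- By the independence hypothesis, their expectations restricted to E are Pr[E] times their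
-- full expectations, which are at most α and β. This leaves
--   3 α β Pr[E] ≤ (α β)² Pr[(l , r) = (s , t)] + 2 α β Pr[E],
-- and the theorem follows.
{-# OPTIONS --safe #-}
module Submission where

open import Defs
open import Data.Nat using (ℕ)
open import Data.Fin using (Fin)
open import Data.Fin.Subset using (Subset)
open import Data.Rational using (ℚ; 1ℚ; _+_; _*_; _≤_)

open import Algebra.Bundles using (CommutativeMonoid)
open import Data.Bool.Base using (Bool; true; false; T; _∧_; _∨_; if_then_else_)
open import Data.Bool.Properties using (T-∧; T-∨; T-≡; ∨-identityʳ; ∧-conicalˡ; ∧-conicalʳ)
  renaming (_≟_ to _≟ᵇ_)
open import Data.Fin.Properties using (_≟_)
open import Data.Fin.Subset using (_∪_; ⁅_⁆; ∣_∣; _∈_)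
open import Data.Fin.Subset.Properties
  using (x∈⁅x⁆; x∈⁅y⁆⇒x≡y; x≢y⇒x∉⁅y⁆; x∈p∪q⁺; ∣⁅x⁆∣≡1; ∣p∣≤∣p∪q∣; p⊆q⇒∣p∣≤∣q∣)
import Data.Integer.Base as ℤ
import Data.Integer.Properties as ℤ
open import Data.List.Base using (List; []; _∷_; map; _++_; concat; allFin)
open import Data.List.Membership.Propositional.Properties using (∈-allFin)
open import Data.List.Properties using (map-++; map-∘; map-cong; concatMap-cong)
import Data.List.Relation.Unary.All as All
open import Data.List.Relation.Unary.All.Properties using (all⁺; all⁻; tabulate⁺)
open import Data.Nat.Base as ℕ using (zero; suc; z≤n; s≤s; NonZero; >-nonZero)
import Data.Nat.Properties as ℕ
open import Data.Product.Base using (_,_; proj₁; proj₂)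
open import Data.Rational.Base
  using (0ℚ; -_; _-_; _/_; toℚᵘ; Positive; NonNegative; nonNegative; nonPositive)
open import Data.Rational.Properties
  using ( ≤-refl; ≤-trans; ≤-reflexive; ≤-total; module ≤-Reasoning
        ; +-assoc; +-identityˡ; +-identityʳ; +-inverseʳ; +-mono-≤; +-monoˡ-≤; +-monoʳ-≤
        ; *-assoc; *-comm; *-identityʳ; *-zeroˡ; *-zeroʳ; *-distribˡ-+
        ; *-monoˡ-≤-nonNeg; *-monoʳ-≤-nonNeg; *-cancelˡ-≤-pos
        ; nonNegative⁻¹; nonNeg*nonNeg⇒nonNeg; nonPos*nonPos⇒nonPos; pos*pos⇒pos; pos⇒nonNeg
        ; nonNeg+pos⇒pos; normalize-nonNeg; normalize-pos
        ; toℚᵘ-injective; toℚᵘ-fromℚᵘ; toℚᵘ-homo-+; toℚᵘ-homo-*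
        ; +-0-commutativeMonoid; +-*-commutativeRing )
  renaming (_≟_ to _≟ℚ_)
open import Algebra.Properties.CommutativeSemigroup
  (CommutativeMonoid.commutativeSemigroup +-0-commutativeMonoid)
  using () renaming (interchange to +-interchange)
import Data.Rational.Unnormalised.Base as ℚᵘ
import Data.Rational.Unnormalised.Properties as ℚᵘ
open import Data.Sum.Base using (inj₁; inj₂)
open import Data.Vec.Base using ([]; _∷_; lookup)
open import Data.Vec.Properties
  using (≡-dec; lookup-zipWith; []=⇒lookup; lookup⇒[]=; tabulate∘lookup; tabulate-cong)
open import Function.Base using (_∘_)
open import Function.Bundles using (Equivalence)
open import Level using (0ℓ)
open import Relation.Binary.Definitions using (DecidableEquality)
open import Relation.Binary.PropositionalEquality
open import Relation.Nullary.Decidable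
  using (⌊_⌋; does; proof; yes; no; toWitness; fromWitness; dec⇒maybe)
open import Relation.Nullary.Negation using (contradiction)
open import Relation.Nullary.Reflects using (Reflects; fromEquivalence; det)
open import Tactic.RingSolver using (solve-∀)
open import Tactic.RingSolver.Core.AlmostCommutativeRing
  using (AlmostCommutativeRing; fromCommutativeRing)

private variable
  A B : Set
  k m n : ℕ

-- Without a zero test the reflective solver fails on identities containing constants.
ℚ-ring : AlmostCommutativeRing 0ℓ 0ℓ
ℚ-ring = fromCommutativeRing +-*-commutativeRing (λ x → dec⇒maybe (0ℚ ≟ℚ x))

*-nonNeg : ∀ {p q} → 0ℚ ≤ p → 0ℚ ≤ q → 0ℚ ≤ p * q
*-nonNeg {p} {q} 0≤p 0≤q =
  nonNegative⁻¹ (p * q) {{nonNeg*nonNeg⇒nonNeg p {{nonNegative 0≤p}} q {{nonNegative 0≤q}}}}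

0≤p*p : ∀ p → 0ℚ ≤ p * p
0≤p*p p with ≤-total 0ℚ p
... | inj₁ 0≤p = *-nonNeg 0≤p 0≤p
... | inj₂ p≤0 = nonNegative⁻¹ (p * p) {{nonPos*nonPos⇒nonPos p {{nonPositive p≤0}} p {{nonPositive p≤0}}}}

p≤q⇒0≤q-p : ∀ {p q} → p ≤ q → 0ℚ ≤ q - p
p≤q⇒0≤q-p {p} {q} p≤q = subst (_≤ q - p) (+-inverseʳ p) (+-monoˡ-≤ (- p) p≤q)

p≤p+q : ∀ p {q} → 0ℚ ≤ q → p ≤ p + q
p≤p+q p {q} 0≤q = subst (_≤ p + q) (+-identityʳ p) (+-monoʳ-≤ p 0≤q)

+-cancelʳ-≤ : ∀ {p q} r → p + r ≤ q + r → p ≤ q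
+-cancelʳ-≤ {p} {q} r p+r≤q+r = subst₂ _≤_ (cancel p) (cancel q) (+-monoˡ-≤ (- r) p+r≤q+r)
  where
  cancel : ∀ x → x + r + - r ≡ x
  cancel x = trans (+-assoc x r (- r)) (trans (cong (x +_) (+-inverseʳ r)) (+-identityʳ x))

-- With s = x + y: if s ≥ 3P the inequality is immediate, otherwise
-- 4 (right − left) = (s − 2P)² (s + P) + (x − y)² (3P − s).
am-gm : ∀ {P x y} → 0ℚ ≤ P → 0ℚ ≤ x → 0ℚ ≤ y →
        P * x * y + P * x * y + P * x * y ≤ P * P * P + x * x * y + x * y * y
am-gm {P} {x} {y} 0≤P 0≤x 0≤y with ≤-total (P + P + P) (x + y)
... | inj₁ 3P≤s = begin
  P * x * y + P * x * y + P * x * y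
    ≤⟨ p≤p+q _ (+-mono-≤ (*-nonNeg (*-nonNeg 0≤P 0≤P) 0≤P) (*-nonNeg (*-nonNeg 0≤x 0≤y) (p≤q⇒0≤q-p 3P≤s))) ⟩
  P * x * y + P * x * y + P * x * y + (P * P * P + x * y * (x + y - (P + P + P)))
    ≡⟨ identity P x y ⟨
  P * P * P + x * x * y + x * y * y ∎
  where
  open ≤-Reasoning
  identity : ∀ P x y → P * P * P + x * x * y + x * y * y
           ≡ P * x * y + P * x * y + P * x * y + (P * P * P + x * y * (x + y - (P + P + P)))
  identity = solve-∀ ℚ-ring
... | inj₂ s≤3P = begin
  P * x * y + P * x * y + P * x * y
    ≤⟨ p≤p+q _ (*-nonNeg (+-mono-≤ (*-nonNeg (0≤p*p (x + y - (P + P))) (+-mono-≤ (+-mono-≤ 0≤x 0≤y) 0≤P))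
                                   (*-nonNeg (0≤p*p (x - y)) (p≤q⇒0≤q-p s≤3P)))
                         (nonNegative⁻¹ (ℤ.+ 1 / 4))) ⟩
  P * x * y + P * x * y + P * x * y
    + ((x + y - (P + P)) * (x + y - (P + P)) * (x + y + P) + (x - y) * (x - y) * (P + P + P - (x + y))) * (ℤ.+ 1 / 4)
    ≡⟨ identity P x y ⟨
  P * P * P + x * x * y + x * y * y ∎
  where
  open ≤-Reasoning
  identity : ∀ P x y → P * P * P + x * x * y + x * y * y
           ≡ P * x * y + P * x * y + P * x * y
             + ((x + y - (P + P)) * (x + y - (P + P)) * (x + y + P) + (x - y) * (x - y) * (P + P + P - (x + y)))
               * (ℤ.+ 1 / 4)
  identity = solve-∀ ℚ-ring

-- AM-GM for the three terms (αβ)² ι, βx and αy, whose product is (αβ)³ when ι = 1 / (x y).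
inverse-product-tangent : ∀ α β x y ι → .{{Positive α}} → .{{Positive β}} → .{{Positive x}} → .{{Positive y}} →
  ι * (x * y) ≡ 1ℚ → α * β + α * β + α * β ≤ (α * β) * (α * β) * ι + β * x + α * y
inverse-product-tangent α β x y ι ι[xy]≡1 = *-cancelˡ-≤-pos (X * Y) {{pos*pos⇒pos X Y}} (begin
  X * Y * (P + P + P)                                ≡⟨ expand-left α β x y ⟩
  P * X * Y + P * X * Y + P * X * Y                  ≤⟨ am-gm (0≤ P) (0≤ X) (0≤ Y) ⟩
  P * P * P + X * X * Y + X * Y * Y                  ≡⟨ cong (λ u → u + X * X * Y + X * Y * Y) P³≡P³[ι[xy]] ⟩
  P * P * P * (ι * (x * y)) + X * X * Y + X * Y * Y  ≡⟨ expand-right α β x y ι ⟩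
  X * Y * (P * P * ι + β * x + α * y)                ∎)
  where
  open ≤-Reasoning
  P = α * β
  X = β * x
  Y = α * y
  instance
    P>0 : Positive P
    P>0 = pos*pos⇒pos α β
    X>0 : Positive X
    X>0 = pos*pos⇒pos β x
    Y>0 : Positive Y
    Y>0 = pos*pos⇒pos α y
  0≤ : ∀ p → .{{Positive p}} → 0ℚ ≤ p
  0≤ p = nonNegative⁻¹ p {{pos⇒nonNeg p}}
  P³≡P³[ι[xy]] : P * P * P ≡ P * P * P * (ι * (x * y))
  P³≡P³[ι[xy]] = trans (sym (*-identityʳ (P * P * P))) (cong (P * P * P *_) (sym ι[xy]≡1))
  expand-left : ∀ α β x y → (β * x) * (α * y) * (α * β + α * β + α * β)
    ≡ (α * β) * (β * x) * (α * y) + (α * β) * (β * x) * (α * y) + (α * β) * (β * x) * (α * y)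
  expand-left = solve-∀ ℚ-ring
  expand-right : ∀ α β x y ι →
    (α * β) * (α * β) * (α * β) * (ι * (x * y)) + (β * x) * (β * x) * (α * y) + (β * x) * (α * y) * (α * y)
    ≡ (β * x) * (α * y) * ((α * β) * (α * β) * ι + β * x + α * y)
  expand-right = solve-∀ ℚ-ring

toℚᵘ-natℚ : ∀ k → toℚᵘ (natℚ k) ℚᵘ.≃ ℚᵘ.mkℚᵘ (ℤ.+ k) 0
toℚᵘ-natℚ k = toℚᵘ-fromℚᵘ (ℚᵘ.mkℚᵘ (ℤ.+ k) 0)

natℚ-+ : ∀ a b → natℚ (a ℕ.+ b) ≡ natℚ a + natℚ b
natℚ-+ a b = toℚᵘ-injective (begin-equality
  toℚᵘ (natℚ (a ℕ.+ b))                      ≃⟨ toℚᵘ-natℚ (a ℕ.+ b) ⟩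
  ℚᵘ.mkℚᵘ (ℤ.+ (a ℕ.+ b)) 0                  ≃⟨ ℚᵘ.*≡* numerators ⟩
  ℚᵘ.mkℚᵘ (ℤ.+ a) 0 ℚᵘ.+ ℚᵘ.mkℚᵘ (ℤ.+ b) 0   ≃⟨ ℚᵘ.+-cong (toℚᵘ-natℚ a) (toℚᵘ-natℚ b) ⟨
  toℚᵘ (natℚ a) ℚᵘ.+ toℚᵘ (natℚ b)           ≃⟨ toℚᵘ-homo-+ (natℚ a) (natℚ b) ⟨
  toℚᵘ (natℚ a + natℚ b)                     ∎)
  where
  open ℚᵘ.≤-Reasoning
  numerators : ℤ.+ (a ℕ.+ b) ℤ.* ℤ.+ 1 ≡ (ℤ.+ a ℤ.* ℤ.+ 1 ℤ.+ ℤ.+ b ℤ.* ℤ.+ 1) ℤ.* ℤ.+ 1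
  numerators = cong (ℤ._* ℤ.+ 1)
    (trans (ℤ.pos-+ a b) (sym (cong₂ ℤ._+_ (ℤ.*-identityʳ (ℤ.+ a)) (ℤ.*-identityʳ (ℤ.+ b)))))

natℚ-* : ∀ a b → natℚ (a ℕ.* b) ≡ natℚ a * natℚ b
natℚ-* a b = toℚᵘ-injective (begin-equality
  toℚᵘ (natℚ (a ℕ.* b))                      ≃⟨ toℚᵘ-natℚ (a ℕ.* b) ⟩
  ℚᵘ.mkℚᵘ (ℤ.+ (a ℕ.* b)) 0                  ≃⟨ ℚᵘ.*≡* (cong (ℤ._* ℤ.+ 1) (ℤ.pos-* a b)) ⟩
  ℚᵘ.mkℚᵘ (ℤ.+ a) 0 ℚᵘ.* ℚᵘ.mkℚᵘ (ℤ.+ b) 0   ≃⟨ ℚᵘ.*-cong (toℚᵘ-natℚ a) (toℚᵘ-natℚ b) ⟨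
  toℚᵘ (natℚ a) ℚᵘ.* toℚᵘ (natℚ b)           ≃⟨ toℚᵘ-homo-* (natℚ a) (natℚ b) ⟨
  toℚᵘ (natℚ a * natℚ b)                     ∎)
  where open ℚᵘ.≤-Reasoning

0≤natℚ : ∀ k → 0ℚ ≤ natℚ k
0≤natℚ k = nonNegative⁻¹ (natℚ k) {{normalize-nonNeg k 1}}

natℚ-pos : ∀ k → .{{NonZero k}} → Positive (natℚ k)
natℚ-pos k = normalize-pos k 1

natℚ-mono-≤ : ∀ {a b} → a ℕ.≤ b → natℚ a ≤ natℚ b
natℚ-mono-≤ {a} {b} a≤b = begin
  natℚ a                      ≤⟨ p≤p+q (natℚ a) (0≤natℚ (b ℕ.∸ a)) ⟩
  natℚ a + natℚ (b ℕ.∸ a)     ≡⟨ natℚ-+ a (b ℕ.∸ a) ⟨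
  natℚ (a ℕ.+ (b ℕ.∸ a))      ≡⟨ cong natℚ (ℕ.m+[n∸m]≡n a≤b) ⟩
  natℚ b                      ∎
  where open ≤-Reasoning

invℕ-inverseˡ : ∀ k → .{{NonZero k}} → invℕ k * natℚ k ≡ 1ℚ
invℕ-inverseˡ (suc k) = toℚᵘ-injective (begin-equality
  toℚᵘ (invℕ (suc k) * natℚ (suc k))                ≃⟨ toℚᵘ-homo-* (invℕ (suc k)) (natℚ (suc k)) ⟩
  toℚᵘ (invℕ (suc k)) ℚᵘ.* toℚᵘ (natℚ (suc k))      ≃⟨ ℚᵘ.*-cong (toℚᵘ-fromℚᵘ (ℚᵘ.mkℚᵘ (ℤ.+ 1) k)) (toℚᵘ-natℚ (suc k)) ⟩
  ℚᵘ.mkℚᵘ (ℤ.+ 1) k ℚᵘ.* ℚᵘ.mkℚᵘ (ℤ.+ suc k) 0      ≃⟨ ℚᵘ.*≡* (cong (λ z → ℤ.+ suc z) k+0≡k*1+0) ⟩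
  toℚᵘ 1ℚ                                          ∎)
  where
  open ℚᵘ.≤-Reasoning
  k+0≡k*1+0 : (k ℕ.+ 0) ℕ.* 1 ≡ k ℕ.* 1 ℕ.+ 0
  k+0≡k*1+0 = trans (ℕ.*-identityʳ (k ℕ.+ 0)) (cong (ℕ._+ 0) (sym (ℕ.*-identityʳ k)))

weighted-tangent : ∀ α β w s t s′ t′ → .{{NonZero s}} → .{{NonZero t}} → .{{Positive α}} → .{{Positive β}} →
  0ℚ ≤ w → s ℕ.≤ s′ → t ℕ.≤ t′ →
  (α * β + α * β + α * β) * w ≤ (α * β) * (α * β) * (w * invℕ (s ℕ.* t)) + β * (w * natℚ s′) + α * (w * natℚ t′)
weighted-tangent α β w s t s′ t′ 0≤w s≤s′ t≤t′ = begin
  (α * β + α * β + α * β) * w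
    ≤⟨ *-monoʳ-≤-nonNeg w {{nonNegative 0≤w}} (begin
         α * β + α * β + α * β
           ≤⟨ inverse-product-tangent α β (natℚ s) (natℚ t) ι ι[st]≡1 ⟩
         (α * β) * (α * β) * ι + β * natℚ s + α * natℚ t
           ≤⟨ +-mono-≤ (+-monoʳ-≤ ((α * β) * (α * β) * ι) (*-monoˡ-≤-nonNeg β {{pos⇒nonNeg β}} (natℚ-mono-≤ s≤s′)))
                       (*-monoˡ-≤-nonNeg α {{pos⇒nonNeg α}} (natℚ-mono-≤ t≤t′)) ⟩
         (α * β) * (α * β) * ι + β * natℚ s′ + α * natℚ t′ ∎) ⟩
  ((α * β) * (α * β) * ι + β * natℚ s′ + α * natℚ t′) * w
    ≡⟨ distribute ((α * β) * (α * β)) β α ι (natℚ s′) (natℚ t′) w ⟩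
  (α * β) * (α * β) * (w * ι) + β * (w * natℚ s′) + α * (w * natℚ t′) ∎
  where
  open ≤-Reasoning
  ι = invℕ (s ℕ.* t)
  instance
    s>0 : Positive (natℚ s)
    s>0 = natℚ-pos s
    t>0 : Positive (natℚ t)
    t>0 = natℚ-pos t
  ι[st]≡1 : ι * (natℚ s * natℚ t) ≡ 1ℚ
  ι[st]≡1 = trans (cong (ι *_) (sym (natℚ-* s t))) (invℕ-inverseˡ (s ℕ.* t) {{ℕ.m*n≢0 s t}})
  distribute : ∀ a b c x y z w → (a * x + b * y + c * z) * w ≡ a * (w * x) + b * (w * y) + c * (w * z)
  distribute = solve-∀ ℚ-ring

sumOver : List A → (A → ℚ) → ℚ
sumOver xs f = sumℚ (map f xs)

sumℚ-++ : ∀ (xs ys : List ℚ) → sumℚ (xs ++ ys) ≡ sumℚ xs + sumℚ ys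
sumℚ-++ []       ys = sym (+-identityˡ (sumℚ ys))
sumℚ-++ (x ∷ xs) ys = trans (cong (x +_) (sumℚ-++ xs ys)) (sym (+-assoc x (sumℚ xs) (sumℚ ys)))

sumℚ-concat : ∀ (xss : List (List ℚ)) → sumℚ (concat xss) ≡ sumℚ (map sumℚ xss)
sumℚ-concat []         = refl
sumℚ-concat (xs ∷ xss) = trans (sumℚ-++ xs (concat xss)) (cong (sumℚ xs +_) (sumℚ-concat xss))

sumOver-++ : ∀ (xs ys : List A) f → sumOver (xs ++ ys) f ≡ sumOver xs f + sumOver ys f
sumOver-++ xs ys f = trans (cong sumℚ (map-++ f xs ys)) (sumℚ-++ (map f xs) (map f ys))

sumOver-map : ∀ (g : A → B) xs f → sumOver (map g xs) f ≡ sumOver xs (f ∘ g)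
sumOver-map g xs f = cong sumℚ (sym (map-∘ xs))

sumOver-cong : ∀ (xs : List A) {f g} → (∀ x → f x ≡ g x) → sumOver xs f ≡ sumOver xs g
sumOver-cong xs f≗g = cong sumℚ (map-cong f≗g xs)

sumOver-zero : ∀ (xs : List A) → sumOver xs (λ _ → 0ℚ) ≡ 0ℚ
sumOver-zero []       = refl
sumOver-zero (x ∷ xs) = trans (+-identityˡ _) (sumOver-zero xs)

sumOver-+ : ∀ (xs : List A) f g → sumOver xs (λ x → f x + g x) ≡ sumOver xs f + sumOver xs g
sumOver-+ []       f g = refl
sumOver-+ (x ∷ xs) f g =
  trans (cong (f x + g x +_) (sumOver-+ xs f g)) (+-interchange (f x) (g x) (sumOver xs f) (sumOver xs g))

sumOver-*ˡ : ∀ (xs : List A) c f → sumOver xs (λ x → c * f x) ≡ c * sumOver xs f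
sumOver-*ˡ []       c f = sym (*-zeroʳ c)
sumOver-*ˡ (x ∷ xs) c f =
  trans (cong (c * f x +_) (sumOver-*ˡ xs c f)) (sym (*-distribˡ-+ c (f x) (sumOver xs f)))

sumOver-mono-≤ : ∀ (xs : List A) {f g} → (∀ x → f x ≤ g x) → sumOver xs f ≤ sumOver xs g
sumOver-mono-≤ []       f≤g = ≤-refl
sumOver-mono-≤ (x ∷ xs) f≤g = +-mono-≤ (f≤g x) (sumOver-mono-≤ xs f≤g)

sumOver-comm : ∀ (xs : List A) (ys : List B) (f : A → B → ℚ) →
               sumOver xs (λ x → sumOver ys (f x)) ≡ sumOver ys (λ y → sumOver xs (λ x → f x y))
sumOver-comm []       ys f = sym (sumOver-zero ys)
sumOver-comm (x ∷ xs) ys f = trans (cong (sumOver ys (f x) +_) (sumOver-comm xs ys f))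
                                   (sym (sumOver-+ ys (f x) (λ y → sumOver xs (λ x′ → f x′ y))))

sumOver-if : ∀ b (xs : List A) f → sumOver xs (λ x → if b then f x else 0ℚ) ≡ (if b then sumOver xs f else 0ℚ)
sumOver-if true  xs f = refl
sumOver-if false xs f = sumOver-zero xs

_≟ˢ_ : DecidableEquality (Subset k)
_≟ˢ_ = ≡-dec _≟ᵇ_

sumOver-allSubsets-suc : ∀ (f : Subset (suc k) → ℚ) →
  sumOver (allSubsets (suc k)) f ≡ sumOver (allSubsets k) (f ∘ (true ∷_)) + sumOver (allSubsets k) (f ∘ (false ∷_))
sumOver-allSubsets-suc {k} f = trans (sumOver-++ (map (true ∷_) Sₖ) (map (false ∷_) Sₖ) f)
  (cong₂ _+_ (sumOver-map (true ∷_) Sₖ f) (sumOver-map (false ∷_) Sₖ f))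
  where Sₖ = allSubsets k

-- Stated with does rather than ⌊_⌋, which does not reduce on (b ∷ A) ≟ˢ (b ∷ X) for open A.
sumOver-allSubsets-point : ∀ (X : Subset k) (h : Subset k → ℚ) →
  sumOver (allSubsets k) (λ A → if does (A ≟ˢ X) then h A else 0ℚ) ≡ h X
sumOver-allSubsets-point []          h = +-identityʳ (h [])
sumOver-allSubsets-point {suc k} (true ∷ X)  h =
  trans (sumOver-allSubsets-suc (λ A → if does (A ≟ˢ (true ∷ X)) then h A else 0ℚ))
        (trans (cong₂ _+_ (sumOver-allSubsets-point X (h ∘ (true ∷_))) (sumOver-zero (allSubsets k)))
               (+-identityʳ (h (true ∷ X))))
sumOver-allSubsets-point {suc k} (false ∷ X) h =
  trans (sumOver-allSubsets-suc (λ A → if does (A ≟ˢ (false ∷ X)) then h A else 0ℚ))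
        (trans (cong₂ _+_ (sumOver-zero (allSubsets k)) (sumOver-allSubsets-point X (h ∘ (false ∷_))))
               (+-identityˡ (h (false ∷ X))))

ΣΣ : (Subset m → Subset n → ℚ) → ℚ
ΣΣ f = sumOver (allSubsets _) (λ S → sumOver (allSubsets _) (f S))

ΣST≡ΣΣ : ∀ (f : Subset m → Subset n → ℚ) → ΣST f ≡ ΣΣ f
ΣST≡ΣΣ {m} {n} f = trans (sumℚ-concat (map (λ S → map (f S) (allSubsets n)) (allSubsets m)))
                         (cong sumℚ (sym (map-∘ (allSubsets m))))

ΣST-cong : ∀ {f g : Subset m → Subset n → ℚ} → (∀ S T → f S T ≡ g S T) → ΣST f ≡ ΣST g
ΣST-cong {m} {n} f≗g = cong sumℚ (concatMap-cong (λ S → map-cong (f≗g S) (allSubsets n)) (allSubsets m))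

ΣST-+ : ∀ (f g : Subset m → Subset n → ℚ) → ΣST (λ S T → f S T + g S T) ≡ ΣST f + ΣST g
ΣST-+ {m} {n} f g = begin
  ΣST (λ S T → f S T + g S T)                             ≡⟨ ΣST≡ΣΣ (λ S T → f S T + g S T) ⟩
  sumOver Sₘ (λ S → sumOver Sₙ (λ T → f S T + g S T))     ≡⟨ sumOver-cong Sₘ (λ S → sumOver-+ Sₙ (f S) (g S)) ⟩
  sumOver Sₘ (λ S → sumOver Sₙ (f S) + sumOver Sₙ (g S))  ≡⟨ sumOver-+ Sₘ _ _ ⟩
  ΣΣ f + ΣΣ g                                             ≡⟨ cong₂ _+_ (ΣST≡ΣΣ f) (ΣST≡ΣΣ g) ⟨
  ΣST f + ΣST g                                           ∎
  where
  open ≡-Reasoning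
  Sₘ = allSubsets m
  Sₙ = allSubsets n

ΣST-*ˡ : ∀ c (f : Subset m → Subset n → ℚ) → ΣST (λ S T → c * f S T) ≡ c * ΣST f
ΣST-*ˡ {m} {n} c f = begin
  ΣST (λ S T → c * f S T)                          ≡⟨ ΣST≡ΣΣ (λ S T → c * f S T) ⟩
  sumOver Sₘ (λ S → sumOver Sₙ (λ T → c * f S T))  ≡⟨ sumOver-cong Sₘ (λ S → sumOver-*ˡ Sₙ c (f S)) ⟩
  sumOver Sₘ (λ S → c * sumOver Sₙ (f S))          ≡⟨ sumOver-*ˡ Sₘ c _ ⟩
  c * ΣΣ f                                         ≡⟨ cong (c *_) (ΣST≡ΣΣ f) ⟨
  c * ΣST f                                        ∎
  where
  open ≡-Reasoning
  Sₘ = allSubsets m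
  Sₙ = allSubsets n

ΣST-linear₃ : ∀ a b c (f g h : Subset m → Subset n → ℚ) →
  ΣST (λ S T → a * f S T + b * g S T + c * h S T) ≡ a * ΣST f + b * ΣST g + c * ΣST h
ΣST-linear₃ a b c f g h = trans (ΣST-+ (λ S T → a * f S T + b * g S T) (λ S T → c * h S T))
  (cong₂ _+_ (trans (ΣST-+ (λ S T → a * f S T) (λ S T → b * g S T)) (cong₂ _+_ (ΣST-*ˡ a f) (ΣST-*ˡ b g)))
             (ΣST-*ˡ c h))

ΣST-mono-≤ : ∀ {f g : Subset m → Subset n → ℚ} → (∀ S T → f S T ≤ g S T) → ΣST f ≤ ΣST g
ΣST-mono-≤ {m} {n} {f} {g} f≤g = begin
  ΣST f  ≡⟨ ΣST≡ΣΣ f ⟩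
  ΣΣ f   ≤⟨ sumOver-mono-≤ (allSubsets m) (λ S → sumOver-mono-≤ (allSubsets n) (f≤g S)) ⟩
  ΣΣ g   ≡⟨ ΣST≡ΣΣ g ⟨
  ΣST g  ∎
  where open ≤-Reasoning

ΣST-nonNeg : ∀ {f : Subset m → Subset n → ℚ} → (∀ S T → 0ℚ ≤ f S T) → 0ℚ ≤ ΣST f
ΣST-nonNeg {m} {n} {f} 0≤f = subst (_≤ ΣST f) ΣST-zero (ΣST-mono-≤ 0≤f)
  where
  ΣST-zero : ΣST {m} {n} (λ _ _ → 0ℚ) ≡ 0ℚ
  ΣST-zero = trans (ΣST≡ΣΣ {m} {n} (λ _ _ → 0ℚ))
    (trans (sumOver-cong (allSubsets m) (λ _ → sumOver-zero (allSubsets n))) (sumOver-zero (allSubsets m)))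

ΣST-comm : ∀ (F : Subset m → Subset n → Subset m → Subset n → ℚ) →
           ΣST (λ A B → ΣST (F A B)) ≡ ΣST (λ S T → ΣST (λ A B → F A B S T))
ΣST-comm {m} {n} F = begin
  ΣST (λ A B → ΣST (F A B))
    ≡⟨ trans (ΣST≡ΣΣ (λ A B → ΣST (F A B))) (sumOver-cong Sₘ λ A → sumOver-cong Sₙ λ B → ΣST≡ΣΣ (F A B)) ⟩
  sumOver Sₘ (λ A → sumOver Sₙ λ B → sumOver Sₘ λ S → sumOver Sₙ λ T → F A B S T)
    ≡⟨ sumOver-cong Sₘ (λ A → sumOver-comm Sₙ Sₘ _) ⟩
  sumOver Sₘ (λ A → sumOver Sₘ λ S → sumOver Sₙ λ B → sumOver Sₙ λ T → F A B S T)
    ≡⟨ sumOver-comm Sₘ Sₘ _ ⟩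
  sumOver Sₘ (λ S → sumOver Sₘ λ A → sumOver Sₙ λ B → sumOver Sₙ λ T → F A B S T)
    ≡⟨ sumOver-cong Sₘ (λ S → sumOver-cong Sₘ λ A → sumOver-comm Sₙ Sₙ _) ⟩
  sumOver Sₘ (λ S → sumOver Sₘ λ A → sumOver Sₙ λ T → sumOver Sₙ λ B → F A B S T)
    ≡⟨ sumOver-cong Sₘ (λ S → sumOver-comm Sₘ Sₙ _) ⟩
  sumOver Sₘ (λ S → sumOver Sₙ λ T → sumOver Sₘ λ A → sumOver Sₙ λ B → F A B S T)
    ≡⟨ trans (ΣST≡ΣΣ (λ S T → ΣST (λ A B → F A B S T)))
             (sumOver-cong Sₘ λ S → sumOver-cong Sₙ λ T → ΣST≡ΣΣ (λ A B → F A B S T)) ⟨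
  ΣST (λ S T → ΣST (λ A B → F A B S T)) ∎
  where
  open ≡-Reasoning
  Sₘ = allSubsets m
  Sₙ = allSubsets n

ΣST-point : ∀ (X : Subset m) (Y : Subset n) (h : Subset m → Subset n → ℚ) →
  ΣST (λ A B → if does (A ≟ˢ X) then (if does (B ≟ˢ Y) then h A B else 0ℚ) else 0ℚ) ≡ h X Y
ΣST-point {m} {n} X Y h = begin
  ΣST (λ A B → if does (A ≟ˢ X) then hY A B else 0ℚ)
    ≡⟨ ΣST≡ΣΣ (λ A B → if does (A ≟ˢ X) then hY A B else 0ℚ) ⟩
  sumOver (allSubsets m) (λ A → sumOver (allSubsets n) (λ B → if does (A ≟ˢ X) then hY A B else 0ℚ))
    ≡⟨ sumOver-cong (allSubsets m) (λ A → sumOver-if (does (A ≟ˢ X)) (allSubsets n) (hY A)) ⟩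
  sumOver (allSubsets m) (λ A → if does (A ≟ˢ X) then sumOver (allSubsets n) (hY A) else 0ℚ)
    ≡⟨ sumOver-allSubsets-point X (λ A → sumOver (allSubsets n) (hY A)) ⟩
  sumOver (allSubsets n) (hY X)
    ≡⟨ sumOver-allSubsets-point Y (h X) ⟩
  h X Y ∎
  where
  open ≡-Reasoning
  hY = λ A B → if does (B ≟ˢ Y) then h A B else 0ℚ

∣p∪q∣≤∣p∣+∣q∣ : ∀ (p q : Subset k) → ∣ p ∪ q ∣ ℕ.≤ ∣ p ∣ ℕ.+ ∣ q ∣
∣p∪q∣≤∣p∣+∣q∣ []          []          = z≤n
∣p∪q∣≤∣p∣+∣q∣ (true ∷ p)  (true ∷ q)  =
  s≤s (ℕ.≤-trans (∣p∪q∣≤∣p∣+∣q∣ p q) (ℕ.+-monoʳ-≤ ∣ p ∣ (ℕ.n≤1+n ∣ q ∣)))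
∣p∪q∣≤∣p∣+∣q∣ (true ∷ p)  (false ∷ q) = s≤s (∣p∪q∣≤∣p∣+∣q∣ p q)
∣p∪q∣≤∣p∣+∣q∣ (false ∷ p) (true ∷ q)  =
  ℕ.≤-trans (s≤s (∣p∪q∣≤∣p∣+∣q∣ p q)) (ℕ.≤-reflexive (sym (ℕ.+-suc ∣ p ∣ ∣ q ∣)))
∣p∪q∣≤∣p∣+∣q∣ (false ∷ p) (false ∷ q) = ∣p∪q∣≤∣p∣+∣q∣ p q

∣p∪⁅x⁆∣≤∣p∣+1 : ∀ (p : Subset k) x → ∣ p ∪ ⁅ x ⁆ ∣ ℕ.≤ ∣ p ∣ ℕ.+ 1
∣p∪⁅x⁆∣≤∣p∣+1 p x = ℕ.≤-trans (∣p∪q∣≤∣p∣+∣q∣ p ⁅ x ⁆) (ℕ.≤-reflexive (cong (∣ p ∣ ℕ.+_) (∣⁅x⁆∣≡1 x)))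

natℚ∣p∪⁅x⁆∣≤natℚ∣p∣+1 : ∀ (p : Subset k) x → natℚ ∣ p ∪ ⁅ x ⁆ ∣ ≤ natℚ ∣ p ∣ + 1ℚ
natℚ∣p∪⁅x⁆∣≤natℚ∣p∣+1 p x = ≤-trans (natℚ-mono-≤ (∣p∪⁅x⁆∣≤∣p∣+1 p x)) (≤-reflexive (natℚ-+ ∣ p ∣ 1))

lookup-true⇒∣p∣≢0 : ∀ {p : Subset k} {x} → lookup p x ≡ true → NonZero ∣ p ∣
lookup-true⇒∣p∣≢0 {p = p} {x} px≡true = >-nonZero (subst (ℕ._≤ ∣ p ∣) (∣⁅x⁆∣≡1 x) (p⊆q⇒∣p∣≤∣q∣ ⁅x⁆⊆p))
  where
  ⁅x⁆⊆p : ∀ {y} → y ∈ ⁅ x ⁆ → y ∈ p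
  ⁅x⁆⊆p y∈⁅x⁆ = subst (_∈ p) (sym (x∈⁅y⁆⇒x≡y x y∈⁅x⁆)) (lookup⇒[]= x p px≡true)

lookup-∪⁅x⁆-self : ∀ (p : Subset k) x → lookup (p ∪ ⁅ x ⁆) x ≡ true
lookup-∪⁅x⁆-self p x = []=⇒lookup (x∈p∪q⁺ {p = p} (inj₂ (x∈⁅x⁆ x)))

lookup-⁅x⁆-other : ∀ {i x : Fin k} → i ≢ x → lookup ⁅ x ⁆ i ≡ false
lookup-⁅x⁆-other {i = i} {x} i≢x with lookup ⁅ x ⁆ i in i∈⁅x⁆
... | true  = contradiction (lookup⇒[]= i ⁅ x ⁆ i∈⁅x⁆) (x≢y⇒x∉⁅y⁆ i≢x)
... | false = refl

lookup-∪⁅x⁆-other : ∀ (p : Subset k) {i x} → i ≢ x → lookup (p ∪ ⁅ x ⁆) i ≡ lookup p i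
lookup-∪⁅x⁆-other p {i} {x} i≢x = begin
  lookup (p ∪ ⁅ x ⁆) i         ≡⟨ lookup-zipWith _∨_ i p ⁅ x ⁆ ⟩
  lookup p i ∨ lookup ⁅ x ⁆ i  ≡⟨ cong (lookup p i ∨_) (lookup-⁅x⁆-other i≢x) ⟩
  lookup p i ∨ false           ≡⟨ ∨-identityʳ (lookup p i) ⟩
  lookup p i                   ∎
  where open ≡-Reasoning

lookup-extensionality : ∀ {p q : Subset k} → (∀ i → lookup p i ≡ lookup q i) → p ≡ q
lookup-extensionality {p = p} {q} eq = trans (sym (tabulate∘lookup p)) (trans (tabulate-cong eq) (tabulate∘lookup q))

agreesAt : Fin k → Subset k → Subset k → Fin k → Bool
agreesAt x A X i = ⌊ i ≟ x ⌋ ∨ ⌊ lookup A i ≟ᵇ lookup X i ⌋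

agreeOff-sound : ∀ {x : Fin k} {A X} → T (agreeOff x A X) → ∀ i → i ≢ x → lookup A i ≡ lookup X i
agreeOff-sound {k} {x} {A} {X} agree i i≢x
  with Equivalence.to (T-∨ {⌊ i ≟ x ⌋}) (All.lookup (all⁺ (agreesAt x A X) (allFin k) agree) (∈-allFin i))
... | inj₁ i≡x   = contradiction (toWitness {a? = i ≟ x} i≡x) i≢x
... | inj₂ Ai≡Xi = toWitness {a? = lookup A i ≟ᵇ lookup X i} Ai≡Xi

agreeOff-complete : ∀ {x : Fin k} {A X} → (∀ i → i ≢ x → lookup A i ≡ lookup X i) → T (agreeOff x A X)
agreeOff-complete {x = x} {A} {X} agree = all⁻ (agreesAt x A X) (tabulate⁺ agrees)
  where
  agrees : ∀ i → T (agreesAt x A X i)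
  agrees i with i ≟ x
  ... | yes _  = _
  ... | no i≢x = fromWitness (agree i i≢x)

atom-reflects-∪⁅x⁆ : ∀ (x : Fin k) A S → Reflects (A ≡ S ∪ ⁅ x ⁆) (lookup A x ∧ agreeOff x A S)
atom-reflects-∪⁅x⁆ x A S = fromEquivalence sound complete
  where
  sound : T (lookup A x ∧ agreeOff x A S) → A ≡ S ∪ ⁅ x ⁆
  sound x∈A∧agree = lookup-extensionality at
    where
    at : ∀ i → lookup A i ≡ lookup (S ∪ ⁅ x ⁆) i
    at i with i ≟ x
    ... | yes refl = trans (Equivalence.to T-≡ (proj₁ (Equivalence.to T-∧ x∈A∧agree)))
                           (sym (lookup-∪⁅x⁆-self S x))
    ... | no i≢x   = trans (agreeOff-sound {A = A} {S} (proj₂ (Equivalence.to T-∧ x∈A∧agree)) i i≢x)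
                           (sym (lookup-∪⁅x⁆-other S i≢x))
  complete : A ≡ S ∪ ⁅ x ⁆ → T (lookup A x ∧ agreeOff x A S)
  complete refl = Equivalence.from T-∧
    ( Equivalence.from T-≡ (lookup-∪⁅x⁆-self S x)
    , agreeOff-complete {A = S ∪ ⁅ x ⁆} {S} (λ i i≢x → lookup-∪⁅x⁆-other S i≢x))

atom-indicator : ∀ (x : Fin k) A S → lookup A x ∧ agreeOff x A S ≡ does (A ≟ˢ (S ∪ ⁅ x ⁆))
atom-indicator x A S = det (atom-reflects-∪⁅x⁆ x A S) (proof (A ≟ˢ (S ∪ ⁅ x ⁆)))

restrict : (Subset m → Subset n → ℚ) → (Subset m → Subset n → Bool) → Subset m → Subset n → ℚ
restrict μ ev S T = if ev S T then μ S T else 0ℚ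

restrict-nonNeg : ∀ {μ : Subset m → Subset n → ℚ} → (∀ S T → 0ℚ ≤ μ S T) → ∀ ev S T → 0ℚ ≤ restrict μ ev S T
restrict-nonNeg 0≤μ ev S T with ev S T
... | true  = 0≤μ S T
... | false = ≤-refl

if-∧ : ∀ a b (x : ℚ) → (if a then (if b then x else 0ℚ) else 0ℚ) ≡ (if a ∧ b then x else 0ℚ)
if-∧ true  b x = refl
if-∧ false b x = refl

if-∧-*-if-∧ : ∀ a b c d (g x : ℚ) →
  (if a ∧ b then g else 0ℚ) * (if c ∧ d then x else 0ℚ) ≡ (if a ∧ c then (if b ∧ d then x * g else 0ℚ) else 0ℚ)
if-∧-*-if-∧ false b     c     d     g x = *-zeroˡ (if c ∧ d then x else 0ℚ)
if-∧-*-if-∧ true  b     false d     g x = *-zeroʳ (if b then g else 0ℚ)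
if-∧-*-if-∧ true  false true  d     g x = *-zeroˡ (if d then x else 0ℚ)
if-∧-*-if-∧ true  true  true  false g x = *-zeroʳ g
if-∧-*-if-∧ true  true  true  true  g x = *-comm g x

Pr-restrict : ∀ (μ : Subset m → Subset n → ℚ) ev ev′ → Pr (restrict μ ev) ev′ ≡ Pr μ (λ S T → ev′ S T ∧ ev S T)
Pr-restrict μ ev ev′ = ΣST-cong (λ S T → if-∧ (ev′ S T) (ev S T) (μ S T))

𝔼 : (Subset m → Subset n → ℚ) → (Subset m → Subset n → ℚ) → ℚ
𝔼 μ X = ΣST (λ S T → μ S T * X S T)

𝔼-nonNeg : ∀ {μ X : Subset m → Subset n → ℚ} → (∀ S T → 0ℚ ≤ μ S T) → (∀ S T → 0ℚ ≤ X S T) → 0ℚ ≤ 𝔼 μ X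
𝔼-nonNeg 0≤μ 0≤X = ΣST-nonNeg (λ S T → *-nonNeg (0≤μ S T) (0≤X S T))

𝔼-mono-≤ : ∀ {μ X Y : Subset m → Subset n → ℚ} → (∀ S T → 0ℚ ≤ μ S T) → (∀ S T → X S T ≤ Y S T) → 𝔼 μ X ≤ 𝔼 μ Y
𝔼-mono-≤ {μ = μ} 0≤μ X≤Y = ΣST-mono-≤ (λ S T → *-monoˡ-≤-nonNeg (μ S T) {{nonNegative (0≤μ S T)}} (X≤Y S T))

𝔼-+1 : ∀ {μ : Subset m → Subset n → ℚ} → ΣST μ ≡ 1ℚ → ∀ X → 𝔼 μ (λ S T → X S T + 1ℚ) ≡ 𝔼 μ X + 1ℚ
𝔼-+1 {μ = μ} Σμ≡1 X = trans (ΣST-cong distrib) (trans (ΣST-+ (λ S T → μ S T * X S T) μ) (cong (𝔼 μ X +_) Σμ≡1))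
  where
  distrib : ∀ S T → μ S T * (X S T + 1ℚ) ≡ μ S T * X S T + μ S T
  distrib S T = trans (*-distribˡ-+ (μ S T) (X S T) 1ℚ) (cong (μ S T * X S T +_) (*-identityʳ (μ S T)))

𝔼-natℚ∣∪⁅x⁆∣≤ : ∀ {μ : Subset m → Subset n → ℚ} → (∀ S T → 0ℚ ≤ μ S T) → ΣST μ ≡ 1ℚ →
  ∀ (V : Subset m → Subset n → Subset k) x → 𝔼 μ (λ S T → natℚ ∣ V S T ∪ ⁅ x ⁆ ∣) ≤ 𝔼 μ (λ S T → natℚ ∣ V S T ∣) + 1ℚ
𝔼-natℚ∣∪⁅x⁆∣≤ {μ = μ} 0≤μ Σμ≡1 V x =
  ≤-trans (𝔼-mono-≤ {μ = μ} 0≤μ (λ S T → natℚ∣p∪⁅x⁆∣≤natℚ∣p∣+1 (V S T) x))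
          (≤-reflexive (𝔼-+1 {μ = μ} Σμ≡1 (λ S T → natℚ ∣ V S T ∣)))

module _ (l : Fin m) (r : Fin n) where

  atomWeight : (Subset m → Subset n → ℚ) → Subset m → Subset n → ℚ
  atomWeight G A B = if lookup A l ∧ lookup B r then G A B else 0ℚ

  -- Every outcome (S , T) lies in exactly one atom (A , B) with l ∈ A and r ∈ B,
  -- namely (S ∪ {l} , T ∪ {r}).
  atom-decomposition : ∀ (μ G : Subset m → Subset n → ℚ) →
    𝔼 μ (λ S T → G (S ∪ ⁅ l ⁆) (T ∪ ⁅ r ⁆)) ≡ ΣST (λ A B → atomWeight G A B * Pr μ (Atom l r A B))
  atom-decomposition μ G = sym (begin
    ΣST (λ A B → atomWeight G A B * Pr μ (Atom l r A B))
      ≡⟨ ΣST-cong (λ A B → sym (ΣST-*ˡ (atomWeight G A B) (restrict μ (Atom l r A B)))) ⟩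
    ΣST (λ A B → ΣST (λ S T → atomWeight G A B * restrict μ (Atom l r A B) S T))
      ≡⟨ ΣST-comm (λ A B S T → atomWeight G A B * restrict μ (Atom l r A B) S T) ⟩
    ΣST (λ S T → ΣST (λ A B → atomWeight G A B * restrict μ (Atom l r A B) S T))
      ≡⟨ ΣST-cong (λ S T → ΣST-cong (λ A B → atom-term A B S T)) ⟩
    ΣST (λ S T → ΣST (λ A B → if does (A ≟ˢ (S ∪ ⁅ l ⁆))
                                 then (if does (B ≟ˢ (T ∪ ⁅ r ⁆)) then μ S T * G A B else 0ℚ) else 0ℚ))
      ≡⟨ ΣST-cong (λ S T → ΣST-point (S ∪ ⁅ l ⁆) (T ∪ ⁅ r ⁆) (λ A B → μ S T * G A B)) ⟩
    𝔼 μ (λ S T → G (S ∪ ⁅ l ⁆) (T ∪ ⁅ r ⁆)) ∎)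
    where
    open ≡-Reasoning
    atom-term : ∀ A B S T → atomWeight G A B * restrict μ (Atom l r A B) S T
      ≡ (if does (A ≟ˢ (S ∪ ⁅ l ⁆)) then (if does (B ≟ˢ (T ∪ ⁅ r ⁆)) then μ S T * G A B else 0ℚ) else 0ℚ)
    atom-term A B S T =
      trans (if-∧-*-if-∧ (lookup A l) (lookup B r) (agreeOff l A S) (agreeOff r B T) (G A B) (μ S T))
            (cong₂ (λ a b → if a then (if b then μ S T * G A B else 0ℚ) else 0ℚ)
                   (atom-indicator l A S) (atom-indicator r B T))

  independent-𝔼-factorises : ∀ (p : Subset m → Subset n → ℚ) → JointlyIndependent p l r →
    ∀ G → 𝔼 (restrict p (InSxT l r)) (λ S T → G (S ∪ ⁅ l ⁆) (T ∪ ⁅ r ⁆))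
          ≡ Pr p (InSxT l r) * 𝔼 p (λ S T → G (S ∪ ⁅ l ⁆) (T ∪ ⁅ r ⁆))
  independent-𝔼-factorises p independent G = begin
    𝔼 (restrict p E) Ĝ
      ≡⟨ atom-decomposition (restrict p E) G ⟩
    ΣST (λ A B → atomWeight G A B * Pr (restrict p E) (Atom l r A B))
      ≡⟨ ΣST-cong (λ A B → cong (atomWeight G A B *_) (trans (Pr-restrict p E (Atom l r A B)) (independent A B))) ⟩
    ΣST (λ A B → atomWeight G A B * (Pr p (Atom l r A B) * q))
      ≡⟨ ΣST-cong (λ A B → rearrange (atomWeight G A B) (Pr p (Atom l r A B))) ⟩
    ΣST (λ A B → q * (atomWeight G A B * Pr p (Atom l r A B)))
      ≡⟨ ΣST-*ˡ q (λ A B → atomWeight G A B * Pr p (Atom l r A B)) ⟩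
    q * ΣST (λ A B → atomWeight G A B * Pr p (Atom l r A B))
      ≡⟨ cong (q *_) (atom-decomposition p G) ⟨
    q * 𝔼 p Ĝ ∎
    where
    open ≡-Reasoning
    E = InSxT l r
    q = Pr p E
    Ĝ = λ S T → G (S ∪ ⁅ l ⁆) (T ∪ ⁅ r ⁆)
    rearrange : ∀ w a → w * (a * q) ≡ q * (w * a)
    rearrange w a = trans (sym (*-assoc w a q)) (*-comm (w * a) q)

tangent-pointwise : ∀ (p : Subset m → Subset n → ℚ) l r α β → .{{Positive α}} → .{{Positive β}} →
  (∀ S T → 0ℚ ≤ p S T) → ∀ S T →
  (α * β + α * β + α * β) * restrict p (InSxT l r) S T
  ≤ (α * β) * (α * β) * (if InSxT l r S T then p S T * invℕ (∣ S ∣ ℕ.* ∣ T ∣) else 0ℚ)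
    + β * (restrict p (InSxT l r) S T * natℚ ∣ S ∪ ⁅ l ⁆ ∣)
    + α * (restrict p (InSxT l r) S T * natℚ ∣ T ∪ ⁅ r ⁆ ∣)
tangent-pointwise p l r α β 0≤p S T with InSxT l r S T in l,r∈S×T
... | true  = weighted-tangent α β (p S T) (∣ S ∣) (∣ T ∣) (∣ S ∪ ⁅ l ⁆ ∣) (∣ T ∪ ⁅ r ⁆ ∣)
                {{lookup-true⇒∣p∣≢0 {p = S} (∧-conicalˡ (lookup S l) _ l,r∈S×T)}}
                {{lookup-true⇒∣p∣≢0 {p = T} (∧-conicalʳ _ (lookup T r) l,r∈S×T)}}
                (0≤p S T) (∣p∣≤∣p∪q∣ S ⁅ l ⁆) (∣p∣≤∣p∪q∣ T ⁅ r ⁆)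
... | false = ≤-reflexive (vanishes (α * β + α * β + α * β) ((α * β) * (α * β)) β α
                                    (natℚ ∣ S ∪ ⁅ l ⁆ ∣) (natℚ ∣ T ∪ ⁅ r ⁆ ∣))
  where
  vanishes : ∀ a b c d x y → a * 0ℚ ≡ b * 0ℚ + c * (0ℚ * x) + d * (0ℚ * y)
  vanishes = solve-∀ ℚ-ring

tangent-average : ∀ (p : Subset m → Subset n → ℚ) l r α β → .{{Positive α}} → .{{Positive β}} →
  (∀ S T → 0ℚ ≤ p S T) →
  (α * β + α * β + α * β) * Pr p (InSxT l r)
  ≤ (α * β) * (α * β) * PrPick p l r
    + β * 𝔼 (restrict p (InSxT l r)) (λ S T → natℚ ∣ S ∪ ⁅ l ⁆ ∣)
    + α * 𝔼 (restrict p (InSxT l r)) (λ S T → natℚ ∣ T ∪ ⁅ r ⁆ ∣)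
tangent-average p l r α β 0≤p = begin
  (α * β + α * β + α * β) * ΣST pE
    ≡⟨ ΣST-*ˡ (α * β + α * β + α * β) pE ⟨
  ΣST (λ S T → (α * β + α * β + α * β) * pE S T)
    ≤⟨ ΣST-mono-≤ (tangent-pointwise p l r α β 0≤p) ⟩
  ΣST (λ S T → (α * β) * (α * β) * pick S T + β * (pE S T * natℚ ∣ S ∪ ⁅ l ⁆ ∣) + α * (pE S T * natℚ ∣ T ∪ ⁅ r ⁆ ∣))
    ≡⟨ ΣST-linear₃ ((α * β) * (α * β)) β α pick (λ S T → pE S T * natℚ ∣ S ∪ ⁅ l ⁆ ∣)
                                                (λ S T → pE S T * natℚ ∣ T ∪ ⁅ r ⁆ ∣) ⟩
  (α * β) * (α * β) * PrPick p l r
    + β * 𝔼 pE (λ S T → natℚ ∣ S ∪ ⁅ l ⁆ ∣) + α * 𝔼 pE (λ S T → natℚ ∣ T ∪ ⁅ r ⁆ ∣) ∎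
  where
  open ≤-Reasoning
  pE = restrict p (InSxT l r)
  pick = λ S T → if InSxT l r S T then p S T * invℕ (∣ S ∣ ℕ.* ∣ T ∣) else 0ℚ

tangent-conclusion : ∀ α β q K → .{{Positive (α * β)}} →
  (α * β + α * β + α * β) * q ≤ α * β * (α * β) * K + β * (q * α) + α * (q * β) → q ≤ K * (α * β)
tangent-conclusion α β q K 3Pq≤ = *-cancelˡ-≤-pos (α * β) (+-cancelʳ-≤ (α * β * q + α * β * q) (begin
  α * β * q + (α * β * q + α * β * q)               ≡⟨ regroup-left α β q ⟩
  (α * β + α * β + α * β) * q                       ≤⟨ 3Pq≤ ⟩
  α * β * (α * β) * K + β * (q * α) + α * (q * β)   ≡⟨ regroup-right α β q K ⟩
  α * β * (K * (α * β)) + (α * β * q + α * β * q)   ∎))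
  where
  open ≤-Reasoning
  regroup-left : ∀ α β q → α * β * q + (α * β * q + α * β * q) ≡ (α * β + α * β + α * β) * q
  regroup-left = solve-∀ ℚ-ring
  regroup-right : ∀ α β q K →
    α * β * (α * β) * K + β * (q * α) + α * (q * β) ≡ α * β * (K * (α * β)) + (α * β * q + α * β * q)
  regroup-right = solve-∀ ℚ-ring

mainTheorem10 : ∀ {m n} (p : Subset m → Subset n → ℚ) (l : Fin m) (r : Fin n)
    → IsDistribution p
    → JointlyIndependent p l r
    → Pr p (InSxT l r) ≤ PrPick p l r * ((ExpCardS p + 1ℚ) * (ExpCardT p + 1ℚ))
mainTheorem10 p l r (0≤p , Σp≡1) independent = tangent-conclusion α β q K {{pos*pos⇒pos α β}} (begin
  (α * β + α * β + α * β) * q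
    ≤⟨ tangent-average p l r α β 0≤p ⟩
  α * β * (α * β) * K + β * 𝔼 pE ∣S∪⁅l⁆∣ + α * 𝔼 pE ∣T∪⁅r⁆∣
    ≡⟨ cong₂ (λ u v → α * β * (α * β) * K + β * u + α * v)
             (independent-𝔼-factorises l r p independent (λ A B → natℚ ∣ A ∣))
             (independent-𝔼-factorises l r p independent (λ A B → natℚ ∣ B ∣)) ⟩
  α * β * (α * β) * K + β * (q * 𝔼 p ∣S∪⁅l⁆∣) + α * (q * 𝔼 p ∣T∪⁅r⁆∣)
    ≤⟨ +-mono-≤ (+-monoʳ-≤ (α * β * (α * β) * K)
                  (*-monoˡ-≤-nonNeg β (*-monoˡ-≤-nonNeg q (𝔼-natℚ∣∪⁅x⁆∣≤ 0≤p Σp≡1 (λ S T → S) l))))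
                (*-monoˡ-≤-nonNeg α (*-monoˡ-≤-nonNeg q (𝔼-natℚ∣∪⁅x⁆∣≤ 0≤p Σp≡1 (λ S T → T) r))) ⟩
  α * β * (α * β) * K + β * (q * α) + α * (q * β) ∎)
  where
  open ≤-Reasoning
  α = ExpCardS p + 1ℚ
  β = ExpCardT p + 1ℚ
  q = Pr p (InSxT l r)
  K = PrPick p l r
  pE = restrict p (InSxT l r)
  ∣S∪⁅l⁆∣ = λ S T → natℚ ∣ S ∪ ⁅ l ⁆ ∣
  ∣T∪⁅r⁆∣ = λ S T → natℚ ∣ T ∪ ⁅ r ⁆ ∣
  instance
    α>0 : Positive α
    α>0 = nonNeg+pos⇒pos (ExpCardS p) {{nonNegative (𝔼-nonNeg 0≤p (λ S T → 0≤natℚ ∣ S ∣))}} 1ℚ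
    β>0 : Positive β
    β>0 = nonNeg+pos⇒pos (ExpCardT p) {{nonNegative (𝔼-nonNeg 0≤p (λ S T → 0≤natℚ ∣ T ∣))}} 1ℚ
    α≥0 : NonNegative α
    α≥0 = pos⇒nonNeg α
    β≥0 : NonNegative β
    β≥0 = pos⇒nonNeg β
    q≥0 : NonNegative q
    q≥0 = nonNegative (ΣST-nonNeg (restrict-nonNeg 0≤p (InSxT l r)))
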